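{- Let $k\geq 2$ and $n\geq 1$ be integers. Define \[ D_{0}:=\{(x_1,\dots,x_k)\in(\{0,1\}^{n})^{k}: \forall i\in[n],\ x_{1}(i) + \dots + x_{k}(i)\leq 1 \}, \] \[ D_{*}:=\{(x_1,\dots,x_k)\in(\{0,1\}^{n})^{k}: \exists \ell\in[n],\ x_{1}(\ell) = \cdots =x_{k}(\ell)=1\text{ and } \forall i\neq \ell,\ x_{1}(i) + \dots + x_{k}(i)\leq 1 \}. \] Let $R=X_1\times\cdots\times X_k\subseteq(\{0,1\}^{n})^{k}$ (with $X_j\subseteq\{0,1\}^n$) be a rectangle such that $|R\cap D_{0}|\geq 2^{ -n/k}\cdot |D_{0}|$. Then $R\cap D_{*}\neq\emptyset$.
   Context: A string $x\in\{0,1\}^n$ represents the subset $\{i: x(i)=1\}$ of $[n]$; $D_0$ is the set of \textsf{no} instances (pairwise disjoint sets) and $D_*$ the set of \textsf{yes} instances (sets sharing exactly one common element, otherwise pairwise disjoint) of $k$-party unique-disjointness. -}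

module Defs where

open import Data.Bool using (Bool; true; false)
open import Data.Nat using (ℕ; zero; suc; _+_; _≤_; _≤?_)
open import Data.Fin using (Fin)
open import Data.Vec using (Vec; []; _∷_; lookup)
open import Data.List using (List; []; _∷_; map; concatMap; filter; length)
open import Data.Product using (Σ; _×_; ∃-syntax)
open import Relation.Binary.PropositionalEquality using (_≡_; _≢_)
open import Relation.Nullary using (Dec)
open import Data.Fin.Properties using (all?)
open import Data.Bool.Properties using () renaming (_≟_ to _≟ᵇ_)

BitStr : ℕ → Set
BitStr n = Vec Bool n

Tuple : ℕ → ℕ → Set
Tuple k n = Vec (BitStr n) k

bit : Bool → ℕ
bit true  = 1
bit false = 0

colSum : ∀ {k n} → Tuple k n → Fin n → ℕ
colSum []       i = 0
colSum (x ∷ xs) i = bit (lookup x i) + colSum xs i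

InD0 : ∀ {k n} → Tuple k n → Set
InD0 {k} {n} x = ∀ (i : Fin n) → colSum x i ≤ 1

InDstar : ∀ {k n} → Tuple k n → Set
InDstar {k} {n} x =
  ∃[ ℓ ] ((∀ (j : Fin k) → lookup (lookup x j) ℓ ≡ true)
         × (∀ (i : Fin n) → i ≢ ℓ → colSum x i ≤ 1))

Rect : ℕ → ℕ → Set
Rect k n = Fin k → BitStr n → Bool

InRect : ∀ {k n} → Rect k n → Tuple k n → Set
InRect {k} X x = ∀ (j : Fin k) → X j (lookup x j) ≡ true

allStrings : (n : ℕ) → List (BitStr n)
allStrings zero    = [] ∷ []
allStrings (suc n) = concatMap (λ v → (false ∷ v) ∷ (true ∷ v) ∷ []) (allStrings n)

allTuples : (k n : ℕ) → List (Tuple k n)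
allTuples zero    n = [] ∷ []
allTuples (suc k) n = concatMap (λ t → map (λ v → v ∷ t) (allStrings n)) (allTuples k n)

inD0? : ∀ {k n} (x : Tuple k n) → Dec (InD0 x)
inD0? x = all? (λ i → colSum x i ≤? 1)

inRect? : ∀ {k n} (X : Rect k n) (x : Tuple k n) → Dec (InRect X x)
inRect? X x = all? (λ j → X j (lookup x j) ≟ᵇ true)

inRD0? : ∀ {k n} (X : Rect k n) (x : Tuple k n) → Dec (InRect X x × InD0 x)
inRD0? X x = Relation.Nullary._×-dec_ (inRect? X x) (inD0? x)
  where import Relation.Nullary

sizeD0 : (k n : ℕ) → ℕ
sizeD0 k n = length (filter inD0? (allTuples k n))

sizeRD0 : ∀ {k n} → Rect k n → ℕ
sizeRD0 {k} {n} X = length (filter (inRD0? X) (allTuples k n))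

{-# OPTIONS --safe #-}
module Submission where

-- |D₀| = (k+1)^n, because a column of a point of D₀ is either zero or a unit vector.
-- A rectangle R avoiding D_* has |R ∩ D₀| ≤ k^n, by induction on n after deleting the first
-- column. Fix the tail t; the first column of a point of R ∩ D₀ is 0 or some e_j, and
-- 0·t ∈ R or e_j·t ∈ R holds exactly when t lies in the rectangle R_j in which party j may have
-- had either bit in the deleted column and everybody else a 0. If 0·t ∈ R then not every e_j·t is
-- in R, since otherwise (1,…,1)·t ∈ R ∩ D_*; hence the number of points over t is at most the
-- number of j with t ∈ R_j. Each R_j again avoids D_*, so |R ∩ D₀| ≤ k · k^(n-1).
-- Finally 2 k^k < (k+1)^k for k ≥ 2 by Bernoulli's inequality, so 2^n |R ∩ D₀|^k < |D₀|^k.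


open import Defs
open import Data.Nat using (ℕ; _≤_; _*_; _^_)
open import Data.Product using (∃-syntax; _×_)

open import Data.Bool using (true; false; _∨_)
open import Data.Bool.Properties using (∨-zeroʳ; ∨-idem) renaming (_≟_ to _≟ᵇ_)
open import Data.Empty using (⊥-elim)
open import Data.Fin using (Fin; zero; suc)
open import Data.Fin.Properties using (any?; all?) renaming (_≟_ to _≟ᶠ_)
open import Data.List using (List; []; _∷_; map; concatMap; filter; length; _++_)
open import Data.Nat using (zero; suc; _+_; _<_; z≤n; s≤s; NonZero)
open import Data.Nat.Properties
open import Data.Nat.Tactic.RingSolver using (solve-∀)
open import Data.Product using (_,_; proj₁; proj₂)
open import Data.Sum using (_⊎_; inj₁; inj₂; [_,_]′)
open import Data.Vec using ([]; _∷_; lookup; replicate)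
open import Data.Vec.Properties using (lookup-replicate)
open import Function using (_∘_)
open import Level using (Level)
open import Relation.Binary.PropositionalEquality
open import Relation.Nullary using (Dec; yes; no; does; ¬_; contradiction)
open import Relation.Nullary.Decidable using (_×-dec_; _⊎-dec_; _→-dec_; ¬?; map′)
open import Relation.Unary using (Decidable)

open import Algebra.Properties.CommutativeSemigroup +-commutativeSemigroup
  using (interchange)
open import Algebra.Properties.CommutativeSemigroup *-commutativeSemigroup
  using () renaming (x∙yz≈y∙xz to *-left-comm; interchange to *-interchange)

private variable
  a b p q : Level
  A : Set a
  B : Set b
  P : Set p
  Q : Set q
  k n : ℕ

ind : Dec P → ℕ
ind P? = bit (does P?)

ind-yes : (P? : Dec P) → P → ind P? ≡ 1
ind-yes (yes _) _  = refl
ind-yes (no ¬p) p = ⊥-elim (¬p p)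

ind-no : (P? : Dec P) → ¬ P → ind P? ≡ 0
ind-no (yes p) ¬p = ⊥-elim (¬p p)
ind-no (no _)  _  = refl

ind≤1 : (P? : Dec P) → ind P? ≤ 1
ind≤1 (yes _) = ≤-refl
ind≤1 (no _)  = z≤n

ind-mono : (P? : Dec P) (Q? : Dec Q) → (P → Q) → ind P? ≤ ind Q?
ind-mono (yes p) (yes _) _ = ≤-refl
ind-mono (yes p) (no ¬q) f = ⊥-elim (¬q (f p))
ind-mono (no _)  _       _ = z≤n

ind-cong : (P? : Dec P) (Q? : Dec Q) → (P → Q) → (Q → P) → ind P? ≡ ind Q?
ind-cong P? Q? f g = ≤-antisym (ind-mono P? Q? f) (ind-mono Q? P? g)

sumL : List A → (A → ℕ) → ℕ
sumL []       f = 0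
sumL (x ∷ xs) f = f x + sumL xs f

sumS : (n : ℕ) → (BitStr n → ℕ) → ℕ
sumS zero    f = f []
sumS (suc n) f = sumS n (λ v → f (false ∷ v) + f (true ∷ v))

sumT : (k n : ℕ) → (Tuple k n → ℕ) → ℕ
sumT zero    n f = f []
sumT (suc k) n f = sumT k n (λ t → sumS n (λ v → f (v ∷ t)))

sumF : (k : ℕ) → (Fin k → ℕ) → ℕ
sumF zero    f = 0
sumF (suc k) f = f zero + sumF k (f ∘ suc)

sumL-cong : ∀ (xs : List A) {f g} → (∀ x → f x ≡ g x) → sumL xs f ≡ sumL xs g
sumL-cong []       e = refl
sumL-cong (x ∷ xs) e = cong₂ _+_ (e x) (sumL-cong xs e)

sumL-++ : ∀ (xs ys : List A) f → sumL (xs ++ ys) f ≡ sumL xs f + sumL ys f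
sumL-++ []       ys f = refl
sumL-++ (x ∷ xs) ys f = trans (cong (f x +_) (sumL-++ xs ys f)) (sym (+-assoc (f x) _ _))

sumL-map : ∀ (g : A → B) xs f → sumL (map g xs) f ≡ sumL xs (f ∘ g)
sumL-map g []       f = refl
sumL-map g (x ∷ xs) f = cong (f (g x) +_) (sumL-map g xs f)

sumL-concatMap : ∀ (g : A → List B) xs f → sumL (concatMap g xs) f ≡ sumL xs (λ x → sumL (g x) f)
sumL-concatMap g []       f = refl
sumL-concatMap g (x ∷ xs) f =
  trans (sumL-++ (g x) (concatMap g xs) f) (cong (sumL (g x) f +_) (sumL-concatMap g xs f))

length-filter≡sumL : ∀ {P : A → Set p} (P? : Decidable P) xs → length (filter P? xs) ≡ sumL xs (ind ∘ P?)
length-filter≡sumL P? []       = refl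
length-filter≡sumL P? (x ∷ xs) with does (P? x)
... | false = length-filter≡sumL P? xs
... | true  = cong suc (length-filter≡sumL P? xs)

sumS-cong : ∀ n {f g : BitStr n → ℕ} → (∀ v → f v ≡ g v) → sumS n f ≡ sumS n g
sumS-cong zero    e = e []
sumS-cong (suc n) e = sumS-cong n (λ v → cong₂ _+_ (e (false ∷ v)) (e (true ∷ v)))

sumT-cong : ∀ k n {f g : Tuple k n → ℕ} → (∀ t → f t ≡ g t) → sumT k n f ≡ sumT k n g
sumT-cong zero    n e = e []
sumT-cong (suc k) n e = sumT-cong k n (λ t → sumS-cong n (λ v → e (v ∷ t)))

sumS-mono : ∀ n {f g : BitStr n → ℕ} → (∀ v → f v ≤ g v) → sumS n f ≤ sumS n g
sumS-mono zero    e = e []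
sumS-mono (suc n) e = sumS-mono n (λ v → +-mono-≤ (e (false ∷ v)) (e (true ∷ v)))

sumT-mono : ∀ k n {f g : Tuple k n → ℕ} → (∀ t → f t ≤ g t) → sumT k n f ≤ sumT k n g
sumT-mono zero    n e = e []
sumT-mono (suc k) n e = sumT-mono k n (λ t → sumS-mono n (λ v → e (v ∷ t)))

sumF-cong : ∀ k {f g : Fin k → ℕ} → (∀ j → f j ≡ g j) → sumF k f ≡ sumF k g
sumF-cong zero    e = refl
sumF-cong (suc k) e = cong₂ _+_ (e zero) (sumF-cong k (e ∘ suc))

sumF-mono : ∀ k {f g : Fin k → ℕ} → (∀ j → f j ≤ g j) → sumF k f ≤ sumF k g
sumF-mono zero    e = z≤n
sumF-mono (suc k) e = +-mono-≤ (e zero) (sumF-mono k (e ∘ suc))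

sumS-0 : ∀ n → sumS n (λ _ → 0) ≡ 0
sumS-0 zero    = refl
sumS-0 (suc n) = sumS-0 n

sumT-0 : ∀ k n → sumT k n (λ _ → 0) ≡ 0
sumT-0 zero    n = refl
sumT-0 (suc k) n = trans (sumT-cong k n (λ _ → sumS-0 n)) (sumT-0 k n)

sumF-const : ∀ k c → sumF k (λ _ → c) ≡ k * c
sumF-const zero    c = refl
sumF-const (suc k) c = cong (c +_) (sumF-const k c)

sumS-+ : ∀ n (f g : BitStr n → ℕ) → sumS n (λ v → f v + g v) ≡ sumS n f + sumS n g
sumS-+ zero    f g = refl
sumS-+ (suc n) f g =
  trans (sumS-cong n (λ v → interchange (f (false ∷ v)) (g (false ∷ v)) (f (true ∷ v)) (g (true ∷ v))))
        (sumS-+ n _ _)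

sumT-+ : ∀ k n (f g : Tuple k n → ℕ) → sumT k n (λ t → f t + g t) ≡ sumT k n f + sumT k n g
sumT-+ zero    n f g = refl
sumT-+ (suc k) n f g = trans (sumT-cong k n (λ t → sumS-+ n _ _)) (sumT-+ k n _ _)

sumS-*ˡ : ∀ n c (f : BitStr n → ℕ) → sumS n (λ v → c * f v) ≡ c * sumS n f
sumS-*ˡ zero    c f = refl
sumS-*ˡ (suc n) c f =
  trans (sumS-cong n (λ v → sym (*-distribˡ-+ c (f (false ∷ v)) (f (true ∷ v))))) (sumS-*ˡ n c _)

sumT-*ˡ : ∀ k n c (f : Tuple k n → ℕ) → sumT k n (λ t → c * f t) ≡ c * sumT k n f
sumT-*ˡ zero    n c f = refl
sumT-*ˡ (suc k) n c f = trans (sumT-cong k n (λ t → sumS-*ˡ n c _)) (sumT-*ˡ k n c _)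

sumT-sumF : ∀ k n m (f : Fin m → Tuple k n → ℕ) →
  sumT k n (λ t → sumF m (λ j → f j t)) ≡ sumF m (λ j → sumT k n (f j))
sumT-sumF k n zero    f = sumT-0 k n
sumT-sumF k n (suc m) f =
  trans (sumT-+ k n _ _) (cong (sumT k n (f zero) +_) (sumT-sumF k n m (f ∘ suc)))

sumS-swap : ∀ m n (f : BitStr m → BitStr n → ℕ) →
  sumS m (λ b → sumS n (f b)) ≡ sumS n (λ v → sumS m (λ b → f b v))
sumS-swap zero    n f = refl
sumS-swap (suc m) n f =
  trans (sumS-cong m (λ b → sym (sumS-+ n _ _))) (sumS-swap m n (λ b v → f (false ∷ b) v + f (true ∷ b) v))

sumT-emptyStrings : ∀ k (f : Tuple k 0 → ℕ) → sumT k 0 f ≡ f (replicate k [])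
sumT-emptyStrings zero    f = refl
sumT-emptyStrings (suc k) f = sumT-emptyStrings k (λ t → f ([] ∷ t))

sumL-allStrings : ∀ n f → sumL (allStrings n) f ≡ sumS n f
sumL-allStrings zero    f = +-identityʳ (f [])
sumL-allStrings (suc n) f =
  trans (sumL-concatMap _ (allStrings n) f)
        (trans (sumL-cong (allStrings n) (λ v → cong (f (false ∷ v) +_) (+-identityʳ (f (true ∷ v)))))
               (sumL-allStrings n _))

sumL-allTuples : ∀ k n f → sumL (allTuples k n) f ≡ sumT k n f
sumL-allTuples zero    n f = +-identityʳ (f [])
sumL-allTuples (suc k) n f =
  trans (sumL-concatMap _ (allTuples k n) f)
        (trans (sumL-cong (allTuples k n) (λ t → trans (sumL-map _ (allStrings n) f) (sumL-allStrings n _)))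
               (sumL-allTuples k n _))

length-filter-allTuples : ∀ k n {P : Tuple k n → Set p} (P? : Decidable P) →
  length (filter P? (allTuples k n)) ≡ sumT k n (ind ∘ P?)
length-filter-allTuples k n P? = trans (length-filter≡sumL P? (allTuples k n)) (sumL-allTuples k n _)

infixr 5 _∷ᶜ_

_∷ᶜ_ : BitStr k → Tuple k n → Tuple k (suc n)
[]       ∷ᶜ []       = []
(b ∷ bs) ∷ᶜ (x ∷ xs) = (b ∷ x) ∷ (bs ∷ᶜ xs)

lookup-∷ᶜ : (b : BitStr k) (t : Tuple k n) (j : Fin k) → lookup (b ∷ᶜ t) j ≡ lookup b j ∷ lookup t j
lookup-∷ᶜ (b ∷ bs) (x ∷ xs) zero    = refl
lookup-∷ᶜ (b ∷ bs) (x ∷ xs) (suc j) = lookup-∷ᶜ bs xs j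

sumT-∷ᶜ : ∀ k n (f : Tuple k (suc n) → ℕ) →
  sumT k (suc n) f ≡ sumT k n (λ t → sumS k (λ b → f (b ∷ᶜ t)))
sumT-∷ᶜ zero    n f = refl
sumT-∷ᶜ (suc k) n f =
  trans (sumT-∷ᶜ k n (λ t → sumS (suc n) (λ v → f (v ∷ t))))
        (sumT-cong k n (λ t → sumS-swap k n (λ b w → f ((false ∷ w) ∷ (b ∷ᶜ t)) + f ((true ∷ w) ∷ (b ∷ᶜ t)))))

weight : BitStr k → ℕ
weight []       = 0
weight (b ∷ bs) = bit b + weight bs

zeros ones : BitStr k
zeros = replicate _ false
ones  = replicate _ true

unit : Fin k → BitStr k
unit zero    = true ∷ zeros
unit (suc j) = false ∷ unit j

weight-zeros : ∀ k → weight (zeros {k}) ≡ 0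
weight-zeros zero    = refl
weight-zeros (suc k) = weight-zeros k

weight-unit : (j : Fin k) → weight (unit j) ≡ 1
weight-unit {suc k} zero = cong suc (weight-zeros k)
weight-unit (suc j)      = weight-unit j

lookup-unit-self : (j : Fin k) → lookup (unit j) j ≡ true
lookup-unit-self zero    = refl
lookup-unit-self (suc j) = lookup-unit-self j

lookup-unit-≢ : {i j : Fin k} → i ≢ j → lookup (unit j) i ≡ false
lookup-unit-≢ {i = zero}  {zero}  i≢j = ⊥-elim (i≢j refl)
lookup-unit-≢ {i = zero}  {suc j} _   = refl
lookup-unit-≢ {i = suc i} {zero}  _   = lookup-replicate i false
lookup-unit-≢ {i = suc i} {suc j} i≢j = lookup-unit-≢ (i≢j ∘ cong suc)

sumS-weight0 : ∀ k (f : BitStr k → ℕ) → (∀ b → 0 < weight b → f b ≡ 0) → sumS k f ≡ f zeros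
sumS-weight0 zero    f _    = refl
sumS-weight0 (suc k) f supp =
  trans (sumS-cong k (λ v → trans (cong (f (false ∷ v) +_) (supp (true ∷ v) (s≤s z≤n))) (+-identityʳ _)))
        (sumS-weight0 k (f ∘ (false ∷_)) (supp ∘ (false ∷_)))

-- The strings of weight at most one are zeros and the unit vectors.
sumS-weight≤1 : ∀ k (f : BitStr k → ℕ) → (∀ b → 1 < weight b → f b ≡ 0) →
  sumS k f ≡ f zeros + sumF k (f ∘ unit)
sumS-weight≤1 zero    f _    = sym (+-identityʳ (f []))
sumS-weight≤1 (suc k) f supp = begin
  sumS k (λ v → f (false ∷ v) + f (true ∷ v))
    ≡⟨ sumS-+ k _ _ ⟩
  sumS k (f ∘ (false ∷_)) + sumS k (f ∘ (true ∷_))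
    ≡⟨ cong₂ _+_ (sumS-weight≤1 k _ (supp ∘ (false ∷_)))
                 (sumS-weight0 k _ (λ b w → supp (true ∷ b) (s≤s w))) ⟩
  (f (false ∷ zeros) + sumF k (f ∘ unit ∘ suc)) + f (unit zero)
    ≡⟨ +-assoc (f zeros) _ _ ⟩
  f zeros + (sumF k (f ∘ unit ∘ suc) + f (unit zero))
    ≡⟨ cong (f zeros +_) (+-comm _ (f (unit zero))) ⟩
  f zeros + sumF (suc k) (f ∘ unit) ∎
  where open ≡-Reasoning

colSum-∷ᶜ-zero : (b : BitStr k) (t : Tuple k n) → colSum (b ∷ᶜ t) zero ≡ weight b
colSum-∷ᶜ-zero []       []       = refl
colSum-∷ᶜ-zero (b ∷ bs) (x ∷ xs) = cong (bit b +_) (colSum-∷ᶜ-zero bs xs)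

colSum-∷ᶜ-suc : (b : BitStr k) (t : Tuple k n) (i : Fin n) → colSum (b ∷ᶜ t) (suc i) ≡ colSum t i
colSum-∷ᶜ-suc []       []       i = refl
colSum-∷ᶜ-suc (b ∷ bs) (x ∷ xs) i = cong (bit (lookup x i) +_) (colSum-∷ᶜ-suc bs xs i)

InD0-∷ᶜ⁺ : (b : BitStr k) (t : Tuple k n) → weight b ≤ 1 → InD0 t → InD0 (b ∷ᶜ t)
InD0-∷ᶜ⁺ b t w d zero    = subst (_≤ 1) (sym (colSum-∷ᶜ-zero b t)) w
InD0-∷ᶜ⁺ b t w d (suc i) = subst (_≤ 1) (sym (colSum-∷ᶜ-suc b t i)) (d i)

InD0-∷ᶜ⁻ : (b : BitStr k) (t : Tuple k n) → InD0 (b ∷ᶜ t) → weight b ≤ 1 × InD0 t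
InD0-∷ᶜ⁻ b t d = subst (_≤ 1) (colSum-∷ᶜ-zero b t) (d zero) , λ i → subst (_≤ 1) (colSum-∷ᶜ-suc b t i) (d (suc i))

InDstar-∷ᶜ : (b : BitStr k) (t : Tuple k n) → weight b ≤ 1 → InDstar t → InDstar (b ∷ᶜ t)
InDstar-∷ᶜ b t w (ℓ , common , rest) = suc ℓ , common′ , rest′
  where
  common′ : ∀ j → lookup (lookup (b ∷ᶜ t) j) (suc ℓ) ≡ true
  common′ j = trans (cong (λ x → lookup x (suc ℓ)) (lookup-∷ᶜ b t j)) (common j)
  rest′ : ∀ i → i ≢ suc ℓ → colSum (b ∷ᶜ t) i ≤ 1
  rest′ zero    _ = subst (_≤ 1) (sym (colSum-∷ᶜ-zero b t)) w
  rest′ (suc i) i≢ = subst (_≤ 1) (sym (colSum-∷ᶜ-suc b t i)) (rest i (i≢ ∘ cong suc))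

InDstar-ones∷ᶜ : (t : Tuple k n) → InD0 t → InDstar (ones ∷ᶜ t)
InDstar-ones∷ᶜ t d = zero , common , rest
  where
  common : ∀ j → lookup (lookup (ones ∷ᶜ t) j) zero ≡ true
  common j = trans (cong (λ x → lookup x zero) (lookup-∷ᶜ ones t j)) (lookup-replicate j true)
  rest : ∀ i → i ≢ zero → colSum (ones ∷ᶜ t) i ≤ 1
  rest zero    i≢ = ⊥-elim (i≢ refl)
  rest (suc i) _  = subst (_≤ 1) (sym (colSum-∷ᶜ-suc ones t i)) (d i)

sumS-ind-InD0-∷ᶜ : (t : Tuple k n) → sumS k (λ b → ind (inD0? (b ∷ᶜ t))) ≡ suc k * ind (inD0? t)
sumS-ind-InD0-∷ᶜ {k} t = begin
  sumS k f                     ≡⟨ sumS-weight≤1 k f (λ b w → ind-no (inD0? (b ∷ᶜ t)) (<⇒≱ w ∘ proj₁ ∘ InD0-∷ᶜ⁻ b t)) ⟩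
  f zeros + sumF k (f ∘ unit)  ≡⟨ cong₂ _+_ (light zeros (≤-trans (≤-reflexive (weight-zeros k)) z≤n))
                                            (trans (sumF-cong k (λ j → light (unit j) (≤-reflexive (weight-unit j))))
                                                   (sumF-const k _)) ⟩
  ind (inD0? t) + k * ind (inD0? t) ∎
  where
  open ≡-Reasoning
  f : BitStr k → ℕ
  f b = ind (inD0? (b ∷ᶜ t))
  light : ∀ b → weight b ≤ 1 → f b ≡ ind (inD0? t)
  light b w = ind-cong (inD0? (b ∷ᶜ t)) (inD0? t) (proj₂ ∘ InD0-∷ᶜ⁻ b t) (InD0-∷ᶜ⁺ b t w)

sizeD0≡ : ∀ k n → sizeD0 k n ≡ suc k ^ n
sizeD0≡ k n = trans (length-filter-allTuples k n inD0?) (sumT-D0 n)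
  where
  sumT-D0 : ∀ n → sumT k n (ind ∘ inD0?) ≡ suc k ^ n
  sumT-D0 zero    = trans (sumT-emptyStrings k _) (ind-yes (inD0? (replicate k [])) (λ ()))
  sumT-D0 (suc n) = begin
    sumT k (suc n) (ind ∘ inD0?)                      ≡⟨ sumT-∷ᶜ k n _ ⟩
    sumT k n (λ t → sumS k (λ b → ind (inD0? (b ∷ᶜ t)))) ≡⟨ sumT-cong k n sumS-ind-InD0-∷ᶜ ⟩
    sumT k n (λ t → suc k * ind (inD0? t))             ≡⟨ sumT-*ˡ k n (suc k) _ ⟩
    suc k * sumT k n (ind ∘ inD0?)                     ≡⟨ cong (suc k *_) (sumT-D0 n) ⟩
    suc k * suc k ^ n                                  ∎
    where open ≡-Reasoning

DstarFree : Rect k n → Set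
DstarFree X = ∀ x → InRect X x → ¬ InDstar x

-- Deleting the first column: party j may have had either bit there, every other party a 0.
tailRect : Rect k (suc n) → Fin k → Rect k n
tailRect X j i v = X i (false ∷ v) ∨ X i (lookup (unit j) i ∷ v)

InRect-∷ᶜ⁻ : (X : Rect k (suc n)) (b : BitStr k) (t : Tuple k n) →
  InRect X (b ∷ᶜ t) → ∀ i → X i (lookup b i ∷ lookup t i) ≡ true
InRect-∷ᶜ⁻ X b t r i = subst (λ x → X i x ≡ true) (lookup-∷ᶜ b t i) (r i)

InRect-∷ᶜ⁺ : (X : Rect k (suc n)) (b : BitStr k) (t : Tuple k n) →
  (∀ i → X i (lookup b i ∷ lookup t i) ≡ true) → InRect X (b ∷ᶜ t)
InRect-∷ᶜ⁺ X b t r i = subst (λ x → X i x ≡ true) (sym (lookup-∷ᶜ b t i)) (r i)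

InRect-tailRect-zeros : (X : Rect k (suc n)) (j : Fin k) (t : Tuple k n) →
  InRect X (zeros ∷ᶜ t) → InRect (tailRect X j) t
InRect-tailRect-zeros X j t r i =
  cong (λ c → c ∨ X i (lookup (unit j) i ∷ lookup t i))
       (subst (λ c → X i (c ∷ lookup t i) ≡ true) (lookup-replicate i false) (InRect-∷ᶜ⁻ X zeros t r i))

InRect-tailRect-unit : (X : Rect k (suc n)) (j : Fin k) (t : Tuple k n) →
  InRect X (unit j ∷ᶜ t) → InRect (tailRect X j) t
InRect-tailRect-unit X j t r i
  rewrite InRect-∷ᶜ⁻ X (unit j) t r i = ∨-zeroʳ _

tailRect-≢ : (X : Rect k (suc n)) {i j : Fin k} → i ≢ j → ∀ v → tailRect X j i v ≡ X i (false ∷ v)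
tailRect-≢ X i≢j v rewrite lookup-unit-≢ i≢j = ∨-idem _

tailRect-self : (X : Rect k (suc n)) (j : Fin k) → ∀ v → tailRect X j j v ≡ X j (false ∷ v) ∨ X j (true ∷ v)
tailRect-self X j v rewrite lookup-unit-self j = refl

InRect-tailRect⁻ : (X : Rect k (suc n)) (j : Fin k) (t : Tuple k n) →
  InRect (tailRect X j) t → InRect X (zeros ∷ᶜ t) ⊎ InRect X (unit j ∷ᶜ t)
InRect-tailRect⁻ X j t r with X j (false ∷ lookup t j) in eq
... | true  = inj₁ (InRect-∷ᶜ⁺ X zeros t zeros-column)
  where
  zeros-column : ∀ i → X i (lookup zeros i ∷ lookup t i) ≡ true
  zeros-column i rewrite lookup-replicate i false with i ≟ᶠ j
  ... | yes refl = eq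
  ... | no i≢j   = trans (sym (tailRect-≢ X i≢j _)) (r i)
... | false = inj₂ (InRect-∷ᶜ⁺ X (unit j) t unit-column)
  where
  unit-column : ∀ i → X i (lookup (unit j) i ∷ lookup t i) ≡ true
  unit-column i with i ≟ᶠ j
  ... | yes refl rewrite lookup-unit-self i =
    subst (λ c → c ∨ X i (true ∷ lookup t i) ≡ true) eq (trans (sym (tailRect-self X i _)) (r i))
  ... | no i≢j   rewrite lookup-unit-≢ i≢j = trans (sym (tailRect-≢ X i≢j _)) (r i)

InRect-ones∷ᶜ : (X : Rect k (suc n)) (t : Tuple k n) → (∀ j → InRect X (unit j ∷ᶜ t)) → InRect X (ones ∷ᶜ t)
InRect-ones∷ᶜ X t r = InRect-∷ᶜ⁺ X ones t λ i →
  subst (λ c → X i (c ∷ lookup t i) ≡ true)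
        (trans (lookup-unit-self i) (sym (lookup-replicate i true)))
        (InRect-∷ᶜ⁻ X (unit i) t (r i) i)

tailRect-DstarFree : (X : Rect k (suc n)) (j : Fin k) → DstarFree X → DstarFree (tailRect X j)
tailRect-DstarFree {k} X j free t r d with InRect-tailRect⁻ X j t r
... | inj₁ r₀ = free (zeros ∷ᶜ t) r₀ (InDstar-∷ᶜ zeros t (≤-trans (≤-reflexive (weight-zeros k)) z≤n) d)
... | inj₂ r₁ = free (unit j ∷ᶜ t) r₁ (InDstar-∷ᶜ (unit j) t (≤-reflexive (weight-unit j)) d)

sumF-ind-< : ∀ k {E : Fin k → Set p} (E? : ∀ j → Dec (E j)) → ¬ (∀ j → E j) → sumF k (ind ∘ E?) < k
sumF-ind-< zero    E? ¬all = ⊥-elim (¬all λ ())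
sumF-ind-< (suc k) E? ¬all with E? zero
... | yes e = s≤s (sumF-ind-< k (E? ∘ suc) λ all → ¬all λ { zero → e ; (suc j) → all j })
... | no _  = s≤s (≤-trans (sumF-mono k (ind≤1 ∘ E? ∘ suc)) (≤-reflexive (trans (sumF-const k 1) (*-identityʳ k))))

ind+sumF-ind≤sumF-ind : ∀ k {E : Fin k → Set p} {Q : Fin k → Set q}
  (P? : Dec P) (E? : ∀ j → Dec (E j)) (Q? : ∀ j → Dec (Q j)) →
  (P → ∀ j → Q j) → (∀ j → E j → Q j) → (P → ¬ (∀ j → E j)) →
  ind P? + sumF k (ind ∘ E?) ≤ sumF k (ind ∘ Q?)
ind+sumF-ind≤sumF-ind k (no _) E? Q? _ E⇒Q _ = sumF-mono k (λ j → ind-mono (E? j) (Q? j) (E⇒Q j))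
ind+sumF-ind≤sumF-ind k (yes p) E? Q? P⇒Q _ P⇒¬allE = begin
  suc (sumF k (ind ∘ E?)) ≤⟨ sumF-ind-< k E? (P⇒¬allE p) ⟩
  k                       ≡⟨ sym (*-identityʳ k) ⟩
  k * 1                   ≡⟨ sym (sumF-const k 1) ⟩
  sumF k (λ _ → 1)        ≡⟨ sumF-cong k (λ j → sym (ind-yes (Q? j) (P⇒Q p j))) ⟩
  sumF k (ind ∘ Q?)       ∎
  where open ≤-Reasoning

sumS-ind-InRD0-∷ᶜ≤ : (X : Rect k (suc n)) → DstarFree X → (t : Tuple k n) →
  sumS k (λ b → ind (inRD0? X (b ∷ᶜ t))) ≤ sumF k (λ j → ind (inRD0? (tailRect X j) t))
sumS-ind-InRD0-∷ᶜ≤ {k} X free t = begin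
  sumS k f                    ≡⟨ sumS-weight≤1 k f heavy ⟩
  f zeros + sumF k (f ∘ unit) ≤⟨ ind+sumF-ind≤sumF-ind k (inRD0? X (zeros ∷ᶜ t)) (λ j → inRD0? X (unit j ∷ᶜ t))
                                   (λ j → inRD0? (tailRect X j) t) zeros⇒tail unit⇒tail zeros⇒¬allUnits ⟩
  sumF k (λ j → ind (inRD0? (tailRect X j) t)) ∎
  where
  open ≤-Reasoning
  f : BitStr k → ℕ
  f b = ind (inRD0? X (b ∷ᶜ t))
  heavy : ∀ b → 1 < weight b → f b ≡ 0
  heavy b w = ind-no (inRD0? X (b ∷ᶜ t)) (<⇒≱ w ∘ proj₁ ∘ InD0-∷ᶜ⁻ b t ∘ proj₂)
  zeros⇒tail : InRect X (zeros ∷ᶜ t) × InD0 (zeros ∷ᶜ t) → ∀ j → InRect (tailRect X j) t × InD0 t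
  zeros⇒tail (r , d) j = InRect-tailRect-zeros X j t r , proj₂ (InD0-∷ᶜ⁻ zeros t d)
  unit⇒tail : ∀ j → InRect X (unit j ∷ᶜ t) × InD0 (unit j ∷ᶜ t) → InRect (tailRect X j) t × InD0 t
  unit⇒tail j (r , d) = InRect-tailRect-unit X j t r , proj₂ (InD0-∷ᶜ⁻ (unit j) t d)
  zeros⇒¬allUnits : InRect X (zeros ∷ᶜ t) × InD0 (zeros ∷ᶜ t) → ¬ (∀ j → InRect X (unit j ∷ᶜ t) × InD0 (unit j ∷ᶜ t))
  zeros⇒¬allUnits (_ , d) all =
    free (ones ∷ᶜ t) (InRect-ones∷ᶜ X t (proj₁ ∘ all)) (InDstar-ones∷ᶜ t (proj₂ (InD0-∷ᶜ⁻ zeros t d)))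

sumT-ind-InRD0≤ : ∀ k n (X : Rect k n) → DstarFree X → sumT k n (ind ∘ inRD0? X) ≤ k ^ n
sumT-ind-InRD0≤ k zero    X free = ≤-trans (≤-reflexive (sumT-emptyStrings k _)) (ind≤1 (inRD0? X (replicate k [])))
sumT-ind-InRD0≤ k (suc n) X free = begin
  sumT k (suc n) (ind ∘ inRD0? X)                                 ≡⟨ sumT-∷ᶜ k n _ ⟩
  sumT k n (λ t → sumS k (λ b → ind (inRD0? X (b ∷ᶜ t))))         ≤⟨ sumT-mono k n (sumS-ind-InRD0-∷ᶜ≤ X free) ⟩
  sumT k n (λ t → sumF k (λ j → ind (inRD0? (tailRect X j) t)))   ≡⟨ sumT-sumF k n k _ ⟩
  sumF k (λ j → sumT k n (ind ∘ inRD0? (tailRect X j)))           ≤⟨ sumF-mono k (λ j →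
                                                                       sumT-ind-InRD0≤ k n (tailRect X j) (tailRect-DstarFree X j free)) ⟩
  sumF k (λ _ → k ^ n)                                            ≡⟨ sumF-const k (k ^ n) ⟩
  k * k ^ n                                                       ∎
  where open ≤-Reasoning

sizeRD0≤ : ∀ k n (X : Rect k n) → DstarFree X → sizeRD0 X ≤ k ^ n
sizeRD0≤ k n X free = ≤-trans (≤-reflexive (length-filter-allTuples k n (inRD0? X))) (sumT-ind-InRD0≤ k n X free)

bernoulli-step : ∀ a m → a ^ m * (a + m) ≤ a * suc a ^ m →
  a ^ suc m * (a + suc m) + m * a ^ m ≤ a * suc a ^ suc m
bernoulli-step a m ih = begin
  a ^ suc m * (a + suc m) + m * a ^ m ≡⟨ expand a m (a ^ m) ⟩
  suc a * (a ^ m * (a + m))           ≤⟨ *-monoʳ-≤ (suc a) ih ⟩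
  suc a * (a * suc a ^ m)             ≡⟨ *-left-comm (suc a) a _ ⟩
  a * suc a ^ suc m                   ∎
  where
  open ≤-Reasoning
  expand : ∀ a m p → a * p * (a + suc m) + m * p ≡ suc a * (p * (a + m))
  expand = solve-∀

-- Bernoulli's inequality (1 + a)^m ≥ a^m + m a^(m-1), multiplied by a.
bernoulli : ∀ a m → a ^ m * (a + m) ≤ a * suc a ^ m
bernoulli a zero    = ≤-reflexive (trans (*-identityˡ (a + 0)) (trans (+-identityʳ a) (sym (*-identityʳ a))))
bernoulli a (suc m) = ≤-trans (m≤m+n _ _) (bernoulli-step a m (bernoulli a m))

bernoulli-strict : ∀ a m .{{_ : NonZero a}} → a ^ suc (suc m) * (a + suc (suc m)) < a * suc a ^ suc (suc m)
bernoulli-strict a m =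
  <-≤-trans (m<m+n _ (≤-trans (m^n>0 a (suc m)) (m≤m+n _ _))) (bernoulli-step a (suc m) (bernoulli a (suc m)))

2*n^n<[1+n]^n : ∀ n → 2 ≤ n → 2 * n ^ n < suc n ^ n
2*n^n<[1+n]^n (suc zero) (s≤s ())
2*n^n<[1+n]^n a@(suc (suc m)) _ = *-cancelˡ-< a _ _ (subst (_< a * suc a ^ a) (double a (a ^ a)) (bernoulli-strict a m))
  where
  double : ∀ a p → p * (a + a) ≡ a * (2 * p)
  double = solve-∀

^-distribʳ-* : ∀ a b n → (a * b) ^ n ≡ a ^ n * b ^ n
^-distribʳ-* a b zero    = refl
^-distribʳ-* a b (suc n) = trans (cong ((a * b) *_) (^-distribʳ-* a b n)) (*-interchange a b (a ^ n) (b ^ n))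

[m^n]^o≡[m^o]^n : ∀ m n o → (m ^ n) ^ o ≡ (m ^ o) ^ n
[m^n]^o≡[m^o]^n m n o = trans (^-*-assoc m n o) (trans (cong (m ^_) (*-comm n o)) (sym (^-*-assoc m o n)))

2^n*[k^n]^k<[1+k]^n^k : ∀ k n → 2 ≤ k → 1 ≤ n → 2 ^ n * (k ^ n) ^ k < (suc k ^ n) ^ k
2^n*[k^n]^k<[1+k]^n^k k n@(suc _) 2≤k _ = begin-strict
  2 ^ n * (k ^ n) ^ k  ≡⟨ cong (2 ^ n *_) ([m^n]^o≡[m^o]^n k n k) ⟩
  2 ^ n * (k ^ k) ^ n  ≡⟨ sym (^-distribʳ-* 2 (k ^ k) n) ⟩
  (2 * k ^ k) ^ n      <⟨ ^-monoˡ-< n (2*n^n<[1+n]^n k 2≤k) ⟩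
  (suc k ^ k) ^ n      ≡⟨ [m^n]^o≡[m^o]^n (suc k) k n ⟩
  (suc k ^ n) ^ k      ∎
  where open ≤-Reasoning

∃-BitStr? : ∀ n {P : BitStr n → Set p} → (∀ v → Dec (P v)) → Dec (∃[ v ] P v)
∃-BitStr? zero    P? = map′ ([] ,_) (λ { ([] , p) → p }) (P? [])
∃-BitStr? (suc n) P? = map′ [ (λ (v , p) → false ∷ v , p) , (λ (v , p) → true ∷ v , p) ]′ byFirstBit
  (∃-BitStr? n (P? ∘ (false ∷_)) ⊎-dec ∃-BitStr? n (P? ∘ (true ∷_)))
  where
  byFirstBit : ∃[ v ] _ → ∃[ v ] _ ⊎ ∃[ v ] _
  byFirstBit (false ∷ v , p) = inj₁ (v , p)
  byFirstBit (true  ∷ v , p) = inj₂ (v , p)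

∃-Tuple? : ∀ k n {P : Tuple k n → Set p} → (∀ x → Dec (P x)) → Dec (∃[ x ] P x)
∃-Tuple? zero    n P? = map′ ([] ,_) (λ { ([] , p) → p }) (P? [])
∃-Tuple? (suc k) n P? = map′ (λ (t , v , p) → v ∷ t , p) (λ { (v ∷ t , p) → t , v , p })
  (∃-Tuple? k n (λ t → ∃-BitStr? n (λ v → P? (v ∷ t))))

inDstar? : (x : Tuple k n) → Dec (InDstar x)
inDstar? x = any? λ ℓ → all? (λ j → lookup (lookup x j) ℓ ≟ᵇ true)
                   ×-dec all? (λ i → ¬? (i ≟ᶠ ℓ) →-dec (colSum x i ≤? 1))

theorem1p1 : (k n : ℕ) → 2 ≤ k → 1 ≤ n → (X : Rect k n) →
    sizeD0 k n ^ k ≤ 2 ^ n * sizeRD0 X ^ k →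
    ∃[ x ] (InRect X x × InDstar x)
theorem1p1 k n 2≤k 1≤n X h with ∃-Tuple? k n (λ x → inRect? X x ×-dec inDstar? x)
... | yes found = found
... | no ∄x = contradiction h (<⇒≱ (begin-strict
  2 ^ n * sizeRD0 X ^ k ≤⟨ *-monoʳ-≤ (2 ^ n) (^-monoˡ-≤ k (sizeRD0≤ k n X free)) ⟩
  2 ^ n * (k ^ n) ^ k   <⟨ 2^n*[k^n]^k<[1+k]^n^k k n 2≤k 1≤n ⟩
  (suc k ^ n) ^ k       ≡⟨ cong (_^ k) (sym (sizeD0≡ k n)) ⟩
  sizeD0 k n ^ k        ∎))
  where
  open ≤-Reasoning
  free : DstarFree X
  free x r d = ∄x (x , r , d)
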